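{- Let $m$ be an odd positive integer, $t=2^{(m+1)/2}$, and $\delta\in\mathbb{F}_{2^{2m}}$. Then $$f(x)=x+\left(\mathrm{Tr}_m^{2m}(x)^{t-1}+\delta\right)^{t+1}$$ is a permutation polynomial of $\mathbb{F}_{2^{2m}}$ and its compositional inverse over $\mathbb{F}_{2^{2m}}$ is $$f^{ -1}(x)=x+\left(\left(\mathrm{Tr}_m^{2m}(x)+\delta^{2^{(m+1)/2}+2^m}+\delta^{2^{(3m+1)/2}+1}\right)^{t-1}+\delta^{2^m}\right)^{t+1}.$$
   Context: $\mathrm{Tr}_m^{2m}(x)=x+x^{2^m}$ is the trace map from $\mathbb{F}_{2^{2m}}$ to $\mathbb{F}_{2^m}$. The compositional inverse of a permutation polynomial $F$ of a finite field $\mathbb{F}$ is the unique polynomial map $F^{ -1}$ with $F(F^{ -1}(x))=F^{ -1}(F(x))=x$ for all $x\in\mathbb{F}$. -}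

module Defs where

open import Level using (Level; _⊔_)
open import Data.Nat as ℕ using (ℕ; _∸_)
open import Data.Nat.DivMod using (_/_)
open import Data.Fin using (Fin)
open import Data.Product using (∃)
open import Relation.Nullary using (¬_)
open import Relation.Binary.PropositionalEquality using () renaming (setoid to ≡-setoid)
open import Function.Bundles using (Inverse)
open import Algebra.Bundles using (CommutativeRing; Semiring)
import Algebra.Definitions.RawSemiring as RS

record IsFiniteFieldOfOrder {c ℓ} (R : CommutativeRing c ℓ) (q : ℕ) : Set (c ⊔ ℓ) where
  open CommutativeRing R
  field
    nontrivial : ¬ (1# ≈ 0#)
    inverse    : ∀ x → ¬ (x ≈ 0#) → ∃ λ y → x * y ≈ 1#
    card       : Inverse setoid (≡-setoid (Fin q))

module OverRing {c ℓ} (R : CommutativeRing c ℓ) (m : ℕ) where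
  open CommutativeRing R
  open RS (Semiring.rawSemiring semiring) using (_^_) public

  Tr : Carrier → Carrier
  Tr x = x + x ^ (2 ℕ.^ m)

  t : ℕ
  t = 2 ℕ.^ ((m ℕ.+ 1) / 2)

  f : Carrier → Carrier → Carrier
  f δ x = x + ((Tr x ^ (t ∸ 1)) + δ) ^ (t ℕ.+ 1)

  e₁ e₂ : ℕ
  e₁ = 2 ℕ.^ ((m ℕ.+ 1) / 2) ℕ.+ 2 ℕ.^ m
  e₂ = 2 ℕ.^ ((3 ℕ.* m ℕ.+ 1) / 2) ℕ.+ 1

  finv : Carrier → Carrier → Carrier
  finv δ x = x + (((Tr x + δ ^ e₁ + δ ^ e₂) ^ (t ∸ 1)) + δ ^ (2 ℕ.^ m)) ^ (t ℕ.+ 1)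

{-# OPTIONS --safe #-}
-- Let q = 2^m, K = {z | z^q = z} ≅ 𝔽_{2^m} and t = 2^((m+1)/2), so t² = 2q.  On K the maps
-- z ↦ z^(t-1) and z ↦ z^(t+1) are mutually inverse because (t-1)(t+1) = 2q-1.  Expanding with
-- the Frobenius x ↦ x^t and taking traces gives, for u ∈ K,
--   Tr((u^(t-1) + δ)^(t+1)) = u + (u^(t-1) + Tr δ)^(t+1) + δ^e₁ + δ^e₂,
-- so the map g δ a x = x + ((Tr x + a)^(t-1) + δ)^(t+1) is undone by g (δ^q) b whenever
-- a = b + δ^e₁ + δ^e₂.  Now f δ = g δ 0 and f⁻¹ δ = g (δ^q) (δ^e₁ + δ^e₂).
module Submission where

open import Defs
open import Algebra.Bundles using (CommutativeRing; Semiring)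
import Algebra.Definitions.RawSemiring as RawSemiring
import Algebra.Properties.CommutativeMonoid.Sum as ProductProperties
import Algebra.Properties.CommutativeSemiring.Exp as CommutativeExp
import Algebra.Properties.Ring as RingProperties
import Algebra.Properties.Semiring.Exp as SemiringExp
import Algebra.Solver.Ring.NaturalCoefficients.Default as NaturalCoefficientsSolver
open import Data.Fin as Fin using (Fin; punchIn)
open import Data.Fin.Permutation using (Permutation′; permutation; remove; punchIn-permute; _⟨$⟩ʳ_)
open import Data.Fin.Properties using (punchInᵢ≢i)
open import Data.List using (_∷_; [])
open import Data.Nat as ℕ using (ℕ; zero; suc; _∸_; _%_; _/_; NonZero; s≤s; z≤n)
open import Data.Nat.DivMod using (m≡m%n+[m/n]*n; m*n/n≡m)
import Data.Nat.Properties as ℕₚ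
import Data.Nat.Tactic.RingSolver as ℕ-Solver
open import Data.Product using (_×_; _,_)
open import Function.Bundles using (Inverse; module Injection)
open import Function.Properties.Inverse using (Inverse⇒Injection)
open import Relation.Binary.PropositionalEquality as ≡ using (_≡_)
open import Relation.Nullary using (¬_; yes; no)

suc[[n∸1]*[n+1]]≡n*n : ∀ n → .{{NonZero n}} → suc ((n ∸ 1) ℕ.* (n ℕ.+ 1)) ≡ n ℕ.* n
suc[[n∸1]*[n+1]]≡n*n (suc n) = ≡.cong suc (ℕ-Solver.solve (n ∷ []))

private
  module Odd {m k : ℕ} (m≡1+k*2 : m ≡ suc (k ℕ.* 2)) where
    m+1≡[1+k]*2 : m ℕ.+ 1 ≡ suc k ℕ.* 2
    m+1≡[1+k]*2 = ≡.trans (≡.cong (ℕ._+ 1) m≡1+k*2) (ℕ-Solver.solve (k ∷ []))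

    [m+1]/2≡1+k : (m ℕ.+ 1) / 2 ≡ suc k
    [m+1]/2≡1+k = ≡.trans (≡.cong (_/ 2) m+1≡[1+k]*2) (m*n/n≡m (suc k) 2)

    [m+1]/2+[m+1]/2≡1+m : (m ℕ.+ 1) / 2 ℕ.+ (m ℕ.+ 1) / 2 ≡ suc m
    [m+1]/2+[m+1]/2≡1+m = begin
      (m ℕ.+ 1) / 2 ℕ.+ (m ℕ.+ 1) / 2 ≡⟨ ≡.cong₂ ℕ._+_ [m+1]/2≡1+k [m+1]/2≡1+k ⟩
      suc k ℕ.+ suc k                 ≡⟨ ℕ-Solver.solve (k ∷ []) ⟩
      suc (k ℕ.* 2) ℕ.+ 1             ≡⟨ ≡.cong (ℕ._+ 1) m≡1+k*2 ⟨
      m ℕ.+ 1                         ≡⟨ ℕ-Solver.solve (m ∷ []) ⟩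
      suc m                           ∎
      where open ≡.≡-Reasoning

    3m+1≡[m+[1+k]]*2 : 3 ℕ.* m ℕ.+ 1 ≡ (m ℕ.+ suc k) ℕ.* 2
    3m+1≡[m+[1+k]]*2 = begin
      3 ℕ.* m ℕ.+ 1             ≡⟨ ℕ-Solver.solve (m ∷ []) ⟩
      m ℕ.* 2 ℕ.+ (m ℕ.+ 1)     ≡⟨ ≡.cong (m ℕ.* 2 ℕ.+_) m+1≡[1+k]*2 ⟩
      m ℕ.* 2 ℕ.+ suc k ℕ.* 2   ≡⟨ ℕ-Solver.solve (m ∷ k ∷ []) ⟩
      (m ℕ.+ suc k) ℕ.* 2       ∎
      where open ≡.≡-Reasoning

    [3m+1]/2≡m+[m+1]/2 : (3 ℕ.* m ℕ.+ 1) / 2 ≡ m ℕ.+ (m ℕ.+ 1) / 2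
    [3m+1]/2≡m+[m+1]/2 = begin
      (3 ℕ.* m ℕ.+ 1) / 2     ≡⟨ ≡.cong (_/ 2) 3m+1≡[m+[1+k]]*2 ⟩
      (m ℕ.+ suc k) ℕ.* 2 / 2 ≡⟨ m*n/n≡m (m ℕ.+ suc k) 2 ⟩
      m ℕ.+ suc k             ≡⟨ ≡.cong (m ℕ.+_) [m+1]/2≡1+k ⟨
      m ℕ.+ (m ℕ.+ 1) / 2     ∎
      where open ≡.≡-Reasoning

module _ (m : ℕ) (m-odd : m % 2 ≡ 1) where
  open Odd {k = m / 2} (≡.trans (m≡m%n+[m/n]*n m 2) (≡.cong (ℕ._+ m / 2 ℕ.* 2) m-odd))

  2^[[m+1]/2]*2^[[m+1]/2]≡2*2^m : 2 ℕ.^ ((m ℕ.+ 1) / 2) ℕ.* 2 ℕ.^ ((m ℕ.+ 1) / 2) ≡ 2 ℕ.* 2 ℕ.^ m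
  2^[[m+1]/2]*2^[[m+1]/2]≡2*2^m =
    ≡.trans (≡.sym (ℕₚ.^-distribˡ-+-* 2 ((m ℕ.+ 1) / 2) ((m ℕ.+ 1) / 2))) (≡.cong (2 ℕ.^_) [m+1]/2+[m+1]/2≡1+m)

  2^[[3m+1]/2]≡2^m*2^[[m+1]/2] : 2 ℕ.^ ((3 ℕ.* m ℕ.+ 1) / 2) ≡ 2 ℕ.^ m ℕ.* 2 ℕ.^ ((m ℕ.+ 1) / 2)
  2^[[3m+1]/2]≡2^m*2^[[m+1]/2] =
    ≡.trans (≡.cong (2 ℕ.^_) [3m+1]/2≡m+[m+1]/2) (ℕₚ.^-distribˡ-+-* 2 m ((m ℕ.+ 1) / 2))


module _ {c ℓ} (R : CommutativeRing c ℓ) where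
  open CommutativeRing R
  open RawSemiring (Semiring.rawSemiring semiring) using (_^_)
  open import Relation.Binary.Reasoning.Setoid setoid

  module Powers where
    open SemiringExp semiring using (^-homo-*; ^-assocʳ)

    [x^a]^b≈[x^b]^a : ∀ x a b → (x ^ a) ^ b ≈ (x ^ b) ^ a
    [x^a]^b≈[x^b]^a x a b = begin
      (x ^ a) ^ b   ≈⟨ ^-assocʳ x a b ⟩
      x ^ (a ℕ.* b) ≡⟨ ≡.cong (x ^_) (ℕₚ.*-comm a b) ⟩
      x ^ (b ℕ.* a) ≈⟨ ^-assocʳ x b a ⟨
      (x ^ b) ^ a   ∎

    1^n≈1 : ∀ n → 1# ^ n ≈ 1#
    1^n≈1 zero    = refl
    1^n≈1 (suc n) = trans (*-identityˡ _) (1^n≈1 n)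

    x^n≈x⇒x^e≈x : ∀ {x n e} → x ^ n ≈ x → suc e ≡ 2 ℕ.* n → x ^ e ≈ x
    x^n≈x⇒x^e≈x {x} {suc n} {e} x^n≈x suc-e≡2n = begin
      x ^ e               ≡⟨ ≡.cong (x ^_) e≡n+[1+n] ⟩
      x ^ (n ℕ.+ suc n)   ≈⟨ ^-homo-* x n (suc n) ⟩
      x ^ n * x ^ suc n   ≈⟨ *-congˡ x^n≈x ⟩
      x ^ n * x           ≈⟨ *-comm _ _ ⟩
      x ^ suc n           ≈⟨ x^n≈x ⟩
      x                   ∎
      where
      e≡n+[1+n] : e ≡ n ℕ.+ suc n
      e≡n+[1+n] = ≡.trans (ℕₚ.suc-injective suc-e≡2n) (≡.cong (n ℕ.+_) (ℕₚ.+-identityʳ (suc n)))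

  module FiniteField where
    open SemiringExp semiring using (^-congˡ; ^-assocʳ)
    open RingProperties ring using (-1*x≈-x; -‿involutive)
    open ProductProperties *-commutativeMonoid
      using (sum-cong-≋; sum-permute; ∑-distrib-+; sum-replicate) renaming (sum to ∏)
    open Powers using (1^n≈1)

    x'*[x*y]≈y : ∀ {x x'} → x' * x ≈ 1# → ∀ y → x' * (x * y) ≈ y
    x'*[x*y]≈y {x} {x'} x'x≈1 y = begin
      x' * (x * y) ≈⟨ *-assoc x' x y ⟨
      (x' * x) * y ≈⟨ *-congʳ x'x≈1 ⟩
      1# * y       ≈⟨ *-identityˡ y ⟩
      y            ∎

    ∏-scale : ∀ {k} a (h : Fin k → Carrier) → ∏ (λ i → a * h i) ≈ a ^ k * ∏ h
    ∏-scale {k} a h = trans (∑-distrib-+ (λ _ → a) h) (*-congʳ (sum-replicate k))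

    module _ {q} (F : IsFiniteFieldOfOrder R q) where
      open IsFiniteFieldOfOrder F

      *-cancelˡ : ∀ {x y z} → ¬ x ≈ 0# → x * y ≈ x * z → y ≈ z
      *-cancelˡ {x} {y} {z} x≉0 xy≈xz with inverse x x≉0
      ... | x' , xx'≈1 = begin
        y            ≈⟨ x'*[x*y]≈y x'x≈1 y ⟨
        x' * (x * y) ≈⟨ *-congˡ xy≈xz ⟩
        x' * (x * z) ≈⟨ x'*[x*y]≈y x'x≈1 z ⟩
        z            ∎
        where
        x'x≈1 : x' * x ≈ 1#
        x'x≈1 = trans (*-comm x' x) xx'≈1

      *-nonzero : ∀ {x y} → ¬ x ≈ 0# → ¬ y ≈ 0# → ¬ x * y ≈ 0#
      *-nonzero {x} x≉0 y≉0 xy≈0 = y≉0 (*-cancelˡ x≉0 (trans xy≈0 (sym (zeroʳ x))))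

      ∏-nonzero : ∀ {k} (h : Fin k → Carrier) → (∀ i → ¬ h i ≈ 0#) → ¬ ∏ h ≈ 0#
      ∏-nonzero {zero}  h h≉0 = nontrivial
      ∏-nonzero {suc k} h h≉0 = *-nonzero (h≉0 Fin.zero) (∏-nonzero (λ i → h (Fin.suc i)) (λ i → h≉0 (Fin.suc i)))

    -- Fermat's little theorem: multiplication by a ≉ 0 permutes the nonzero elements.
    module _ {n} (F : IsFiniteFieldOfOrder R (suc n)) where
      open IsFiniteFieldOfOrder F
      open Inverse card using (to; from; to-cong; strictlyInverseˡ; strictlyInverseʳ)

      private
        0ᶠ : Fin (suc n)
        0ᶠ = to 0#

        nonzero : Fin n → Carrier
        nonzero j = from (punchIn 0ᶠ j)

        nonzero≉0 : ∀ j → ¬ nonzero j ≈ 0#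
        nonzero≉0 j nonzero≈0 = punchInᵢ≢i 0ᶠ j (≡.trans (≡.sym (strictlyInverseˡ _)) (to-cong nonzero≈0))

        scale : Carrier → Fin (suc n) → Fin (suc n)
        scale a i = to (a * from i)

        scale-inverse : ∀ {a a'} → a' * a ≈ 1# → ∀ i → scale a' (scale a i) ≡ i
        scale-inverse {a} {a'} a'a≈1 i = ≡.trans (to-cong (begin
          a' * from (to (a * from i)) ≈⟨ *-congˡ (strictlyInverseʳ _) ⟩
          a' * (a * from i)           ≈⟨ x'*[x*y]≈y a'a≈1 (from i) ⟩
          from i                      ∎)) (strictlyInverseˡ i)

        scale-0ᶠ : ∀ a → scale a 0ᶠ ≡ 0ᶠ
        scale-0ᶠ a = to-cong (trans (*-congˡ (strictlyInverseʳ 0#)) (zeroʳ a))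

        x^n≈1 : ∀ {x} → ¬ x ≈ 0# → x ^ n ≈ 1#
        x^n≈1 {x} x≉0 with inverse x x≉0
        ... | x' , xx'≈1 = *-cancelˡ F (∏-nonzero F nonzero nonzero≉0) (begin
          ∏ nonzero * x ^ n             ≈⟨ *-comm _ _ ⟩
          x ^ n * ∏ nonzero             ≈⟨ ∏-scale x nonzero ⟨
          ∏ (λ j → x * nonzero j)       ≈⟨ sum-cong-≋ nonzero-permute ⟨
          ∏ (λ j → nonzero (π₀ ⟨$⟩ʳ j)) ≈⟨ sum-permute nonzero π₀ ⟨
          ∏ nonzero                     ≈⟨ *-identityʳ _ ⟨
          ∏ nonzero * 1#                ∎)
          where
          π : Permutation′ (suc n)
          π = permutation (scale x) (scale x') (scale-inverse xx'≈1) (scale-inverse (trans (*-comm x' x) xx'≈1))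
          π₀ : Permutation′ n
          π₀ = remove 0ᶠ π
          nonzero-permute : ∀ j → nonzero (π₀ ⟨$⟩ʳ j) ≈ x * nonzero j
          nonzero-permute j = begin
            from (punchIn 0ᶠ (π₀ ⟨$⟩ʳ j))          ≡⟨ ≡.cong (λ i → from (punchIn i (π₀ ⟨$⟩ʳ j))) (scale-0ᶠ x) ⟨
            from (punchIn (π ⟨$⟩ʳ 0ᶠ) (π₀ ⟨$⟩ʳ j)) ≡⟨ ≡.cong from (punchIn-permute π 0ᶠ j) ⟨
            from (π ⟨$⟩ʳ punchIn 0ᶠ j)            ≈⟨ strictlyInverseʳ _ ⟩
            x * nonzero j                          ∎

      x^[1+n]≈x : ∀ x → x ^ suc n ≈ x
      x^[1+n]≈x x with to x Fin.≟ 0ᶠ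
      ... | yes x≡0 = trans (*-congʳ x≈0) (trans (zeroˡ _) (sym x≈0))
        where
        x≈0 : x ≈ 0#
        x≈0 = Injection.injective (Inverse⇒Injection card) x≡0
      ... | no x≢0 = trans (*-congˡ (x^n≈1 (λ x≈0 → x≢0 (to-cong x≈0)))) (*-identityʳ x)

    x^q≈x : ∀ {q} → IsFiniteFieldOfOrder R q → ∀ x → x ^ q ≈ x
    x^q≈x {zero}  F with Inverse.to (IsFiniteFieldOfOrder.card F) 0#
    ... | ()
    x^q≈x {suc n} F = x^[1+n]≈x F

    x+x≈0 : ∀ {k} .{{_ : NonZero k}} → IsFiniteFieldOfOrder R (2 ℕ.^ k) → ∀ x → x + x ≈ 0#
    x+x≈0 {suc k} F x = begin
      x + x   ≈⟨ +-congˡ -x≈x ⟨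
      x + - x ≈⟨ -‿inverseʳ x ⟩
      0#      ∎
      where
      -1≈1 : - 1# ≈ 1#
      -1≈1 = begin
        - 1#                     ≈⟨ x^q≈x F (- 1#) ⟨
        (- 1#) ^ (2 ℕ.^ suc k)   ≈⟨ ^-assocʳ (- 1#) 2 (2 ℕ.^ k) ⟨
        ((- 1#) ^ 2) ^ (2 ℕ.^ k) ≈⟨ ^-congˡ (2 ℕ.^ k) [-1]^2≈1 ⟩
        1# ^ (2 ℕ.^ k)           ≈⟨ 1^n≈1 (2 ℕ.^ k) ⟩
        1#                       ∎
        where
        [-1]^2≈1 : (- 1#) ^ 2 ≈ 1#
        [-1]^2≈1 = trans (*-congˡ (*-identityʳ _)) (trans (-1*x≈-x (- 1#)) (-‿involutive 1#))
      -x≈x : - x ≈ x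
      -x≈x = trans (sym (-1*x≈-x x)) (trans (*-congʳ -1≈1) (*-identityˡ x))

  module Characteristic2 (x+x≈0 : ∀ x → x + x ≈ 0#) where
    open SemiringExp semiring using (^-congˡ; ^-assocʳ)
    open NaturalCoefficientsSolver commutativeSemiring

    x+[y+y]≈x : ∀ x y → x + (y + y) ≈ x
    x+[y+y]≈x x y = trans (+-congˡ (x+x≈0 y)) (+-identityʳ x)

    [x+y]+y≈x : ∀ x y → (x + y) + y ≈ x
    [x+y]+y≈x x y = trans (+-assoc x y y) (x+[y+y]≈x x y)

    [x+y]^2≈x^2+y^2 : ∀ x y → (x + y) ^ 2 ≈ x ^ 2 + y ^ 2
    [x+y]^2≈x^2+y^2 x y = begin
      (x + y) ^ 2                       ≈⟨ solve 2 (λ x y → (x :+ y) :* ((x :+ y) :* con 1)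
                                             := (x :* (x :* con 1) :+ y :* (y :* con 1)) :+ (x :* y :+ x :* y))
                                             refl x y ⟩
      (x ^ 2 + y ^ 2) + (x * y + x * y) ≈⟨ x+[y+y]≈x _ _ ⟩
      x ^ 2 + y ^ 2                     ∎

    [x+y]^2^k≈x^2^k+y^2^k : ∀ k x y → (x + y) ^ (2 ℕ.^ k) ≈ x ^ (2 ℕ.^ k) + y ^ (2 ℕ.^ k)
    [x+y]^2^k≈x^2^k+y^2^k zero    x y = trans (*-identityʳ _) (sym (+-cong (*-identityʳ x) (*-identityʳ y)))
    [x+y]^2^k≈x^2^k+y^2^k (suc k) x y = begin
      (x + y) ^ (2 ℕ.* 2 ℕ.^ k)                   ≈⟨ ^-assocʳ (x + y) 2 (2 ℕ.^ k) ⟨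
      ((x + y) ^ 2) ^ (2 ℕ.^ k)                   ≈⟨ ^-congˡ (2 ℕ.^ k) ([x+y]^2≈x^2+y^2 x y) ⟩
      (x ^ 2 + y ^ 2) ^ (2 ℕ.^ k)                 ≈⟨ [x+y]^2^k≈x^2^k+y^2^k k (x ^ 2) (y ^ 2) ⟩
      (x ^ 2) ^ (2 ℕ.^ k) + (y ^ 2) ^ (2 ℕ.^ k)   ≈⟨ +-cong (^-assocʳ x 2 (2 ℕ.^ k)) (^-assocʳ y 2 (2 ℕ.^ k)) ⟩
      x ^ (2 ℕ.* 2 ℕ.^ k) + y ^ (2 ℕ.* 2 ℕ.^ k)   ∎

  module Trace (x+x≈0 : ∀ x → x + x ≈ 0#) (m : ℕ) (x^[2^2m]≈x : ∀ x → x ^ (2 ℕ.^ (2 ℕ.* m)) ≈ x) where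
    open OverRing R m using (Tr)
    open SemiringExp semiring using (^-congˡ; ^-assocʳ)
    open CommutativeExp commutativeSemiring using (^-distrib-*)
    open Powers
    open Characteristic2 x+x≈0
    open NaturalCoefficientsSolver commutativeSemiring

    q : ℕ
    q = 2 ℕ.^ m

    [x^q]^q≈x : ∀ x → (x ^ q) ^ q ≈ x
    [x^q]^q≈x x = begin
      (x ^ q) ^ q           ≈⟨ ^-assocʳ x q q ⟩
      x ^ (q ℕ.* q)         ≡⟨ ≡.cong (x ^_) q*q≡2^2m ⟩
      x ^ (2 ℕ.^ (2 ℕ.* m)) ≈⟨ x^[2^2m]≈x x ⟩
      x                     ∎
      where
      q*q≡2^2m : q ℕ.* q ≡ 2 ℕ.^ (2 ℕ.* m)
      q*q≡2^2m = ≡.trans (≡.sym (ℕₚ.^-distribˡ-+-* 2 m m)) (≡.cong (λ n → 2 ℕ.^ (m ℕ.+ n)) (≡.sym (ℕₚ.+-identityʳ m)))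

    InSubfield : Carrier → Set ℓ
    InSubfield z = z ^ q ≈ z

    InSubfield-resp : ∀ {x y} → x ≈ y → InSubfield x → InSubfield y
    InSubfield-resp {x} {y} x≈y x∈K = trans (^-congˡ q (sym x≈y)) (trans x∈K x≈y)

    InSubfield-+ : ∀ {x y} → InSubfield x → InSubfield y → InSubfield (x + y)
    InSubfield-+ {x} {y} x∈K y∈K = trans ([x+y]^2^k≈x^2^k+y^2^k m x y) (+-cong x∈K y∈K)

    InSubfield-^ : ∀ {x} → InSubfield x → ∀ n → InSubfield (x ^ n)
    InSubfield-^ {x} x∈K n = trans ([x^a]^b≈[x^b]^a x n q) (^-congˡ n x∈K)

    InSubfield-0# : InSubfield 0#
    InSubfield-0# = InSubfield-resp (x+x≈0 1#) (InSubfield-+ (1^n≈1 q) (1^n≈1 q))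

    InSubfield-Tr : ∀ x → InSubfield (Tr x)
    InSubfield-Tr x = begin
      (x + x ^ q) ^ q           ≈⟨ [x+y]^2^k≈x^2^k+y^2^k m x (x ^ q) ⟩
      x ^ q + (x ^ q) ^ q       ≈⟨ +-congˡ ([x^q]^q≈x x) ⟩
      x ^ q + x                 ≈⟨ +-comm _ _ ⟩
      x + x ^ q                 ∎

    Tr-cong : ∀ {x y} → x ≈ y → Tr x ≈ Tr y
    Tr-cong x≈y = +-cong x≈y (^-congˡ q x≈y)

    Tr-+ : ∀ x y → Tr (x + y) ≈ Tr x + Tr y
    Tr-+ x y = begin
      (x + y) + (x + y) ^ q       ≈⟨ +-congˡ ([x+y]^2^k≈x^2^k+y^2^k m x y) ⟩
      (x + y) + (x ^ q + y ^ q)   ≈⟨ solve 4 (λ x y x' y' → (x :+ y) :+ (x' :+ y') := (x :+ x') :+ (y :+ y'))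
                                       refl x y (x ^ q) (y ^ q) ⟩
      (x + x ^ q) + (y + y ^ q)   ∎

    Tr-*ˡ : ∀ {a} → InSubfield a → ∀ x → Tr (a * x) ≈ a * Tr x
    Tr-*ˡ {a} a∈K x = begin
      a * x + (a * x) ^ q      ≈⟨ +-congˡ (^-distrib-* a x q) ⟩
      a * x + a ^ q * x ^ q    ≈⟨ +-congˡ (*-congʳ a∈K) ⟩
      a * x + a * x ^ q        ≈⟨ distribˡ a x (x ^ q) ⟨
      a * (x + x ^ q)          ∎

    Tr-^2^k : ∀ k x → Tr (x ^ (2 ℕ.^ k)) ≈ Tr x ^ (2 ℕ.^ k)
    Tr-^2^k k x = begin
      x ^ (2 ℕ.^ k) + (x ^ (2 ℕ.^ k)) ^ q   ≈⟨ +-congˡ ([x^a]^b≈[x^b]^a x (2 ℕ.^ k) q) ⟩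
      x ^ (2 ℕ.^ k) + (x ^ q) ^ (2 ℕ.^ k)   ≈⟨ [x+y]^2^k≈x^2^k+y^2^k k x (x ^ q) ⟨
      (x + x ^ q) ^ (2 ℕ.^ k)               ∎

    Tr≈0 : ∀ {z} → InSubfield z → Tr z ≈ 0#
    Tr≈0 {z} z∈K = trans (+-congˡ z∈K) (x+x≈0 z)

  module PermutationPolynomial (x+x≈0 : ∀ x → x + x ≈ 0#) (m : ℕ) (m-odd : m % 2 ≡ 1)
                               (x^[2^2m]≈x : ∀ x → x ^ (2 ℕ.^ (2 ℕ.* m)) ≈ x) where
    open OverRing R m using (Tr; t; e₁; e₂; f; finv)
    open SemiringExp semiring using (^-congˡ; ^-homo-*; ^-assocʳ)
    open CommutativeExp commutativeSemiring using (^-distrib-*)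
    open Powers
    open Characteristic2 x+x≈0
    open Trace x+x≈0 m x^[2^2m]≈x
    open NaturalCoefficientsSolver commutativeSemiring

    instance
      t-nonZero : NonZero t
      t-nonZero = ℕₚ.m^n≢0 2 ((m ℕ.+ 1) / 2)

    z^[[t∸1]*[t+1]]≈z : ∀ {z} → InSubfield z → z ^ ((t ∸ 1) ℕ.* (t ℕ.+ 1)) ≈ z
    z^[[t∸1]*[t+1]]≈z z∈K =
      x^n≈x⇒x^e≈x {n = q} z∈K (≡.trans (suc[[n∸1]*[n+1]]≡n*n t) (2^[[m+1]/2]*2^[[m+1]/2]≡2*2^m m m-odd))

    [z^[t∸1]]^[t+1]≈z : ∀ {z} → InSubfield z → (z ^ (t ∸ 1)) ^ (t ℕ.+ 1) ≈ z
    [z^[t∸1]]^[t+1]≈z {z} z∈K = trans (^-assocʳ z (t ∸ 1) (t ℕ.+ 1)) (z^[[t∸1]*[t+1]]≈z z∈K)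

    [z^[t+1]]^[t∸1]≈z : ∀ {z} → InSubfield z → (z ^ (t ℕ.+ 1)) ^ (t ∸ 1) ≈ z
    [z^[t+1]]^[t∸1]≈z {z} z∈K = trans ([x^a]^b≈[x^b]^a z (t ℕ.+ 1) (t ∸ 1)) ([z^[t∸1]]^[t+1]≈z z∈K)

    cross : Carrier → Carrier → Carrier
    cross x y = x ^ t * y + x * y ^ t

    cross-comm : ∀ x y → cross x y ≈ cross y x
    cross-comm x y = trans (+-comm _ _) (+-cong (*-comm _ _) (*-comm _ _))

    [x+y]^[t+1] : ∀ x y → (x + y) ^ (t ℕ.+ 1) ≈ x ^ (t ℕ.+ 1) + cross x y + y ^ (t ℕ.+ 1)
    [x+y]^[t+1] x y = begin
      (x + y) ^ (t ℕ.+ 1)                       ≈⟨ x^[t+1]≈x^t*x (x + y) ⟩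
      (x + y) ^ t * (x + y)                     ≈⟨ *-congʳ ([x+y]^2^k≈x^2^k+y^2^k ((m ℕ.+ 1) / 2) x y) ⟩
      (x ^ t + y ^ t) * (x + y)                 ≈⟨ solve 4 (λ x y x' y' → (x' :+ y') :* (x :+ y)
                                                  := x' :* x :+ (x' :* y :+ x :* y') :+ y' :* y) refl x y (x ^ t) (y ^ t) ⟩
      x ^ t * x + cross x y + y ^ t * y         ≈⟨ +-cong (+-congʳ (x^[t+1]≈x^t*x x)) (x^[t+1]≈x^t*x y) ⟨
      x ^ (t ℕ.+ 1) + cross x y + y ^ (t ℕ.+ 1) ∎
      where
      x^[t+1]≈x^t*x : ∀ x → x ^ (t ℕ.+ 1) ≈ x ^ t * x
      x^[t+1]≈x^t*x x = trans (^-homo-* x t 1) (*-congˡ (*-identityʳ x))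

    Tr-cross : ∀ {a} → InSubfield a → ∀ x → Tr (cross a x) ≈ cross a (Tr x)
    Tr-cross {a} a∈K x = begin
      Tr (a ^ t * x + a * x ^ t)        ≈⟨ Tr-+ _ _ ⟩
      Tr (a ^ t * x) + Tr (a * x ^ t)   ≈⟨ +-cong (Tr-*ˡ (InSubfield-^ a∈K t) x) (Tr-*ˡ a∈K (x ^ t)) ⟩
      a ^ t * Tr x + a * Tr (x ^ t)     ≈⟨ +-congˡ (*-congˡ (Tr-^2^k ((m ℕ.+ 1) / 2) x)) ⟩
      a ^ t * Tr x + a * Tr x ^ t       ∎

    correction : Carrier → Carrier
    correction δ = δ ^ e₁ + δ ^ e₂

    correction≈cross : ∀ δ → correction δ ≈ cross δ (δ ^ q)
    correction≈cross δ = +-cong (^-homo-* δ t q) (begin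
      δ ^ e₂                  ≡⟨ ≡.cong (λ e → δ ^ (e ℕ.+ 1)) (2^[[3m+1]/2]≡2^m*2^[[m+1]/2] m m-odd) ⟩
      δ ^ (q ℕ.* t ℕ.+ 1)     ≈⟨ ^-homo-* δ (q ℕ.* t) 1 ⟩
      δ ^ (q ℕ.* t) * δ ^ 1   ≈⟨ *-cong (sym (^-assocʳ δ q t)) (*-identityʳ δ) ⟩
      (δ ^ q) ^ t * δ         ≈⟨ *-comm _ _ ⟩
      δ * (δ ^ q) ^ t         ∎)

    correction-^q : ∀ δ → correction (δ ^ q) ≈ correction δ
    correction-^q δ = begin
      correction (δ ^ q)          ≈⟨ correction≈cross (δ ^ q) ⟩
      cross (δ ^ q) ((δ ^ q) ^ q) ≈⟨ +-cong (*-congˡ ([x^q]^q≈x δ)) (*-congˡ (^-congˡ t ([x^q]^q≈x δ))) ⟩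
      cross (δ ^ q) δ             ≈⟨ cross-comm (δ ^ q) δ ⟩
      cross δ (δ ^ q)             ≈⟨ correction≈cross δ ⟨
      correction δ                ∎

    -- correction δ is the trace of δ ^ e₁.
    InSubfield-correction : ∀ δ → InSubfield (correction δ)
    InSubfield-correction δ = InSubfield-resp Tr[δ^e₁]≈correction (InSubfield-Tr (δ ^ e₁))
      where
      Tr[δ^e₁]≈correction : Tr (δ ^ e₁) ≈ correction δ
      Tr[δ^e₁]≈correction = begin
        δ ^ e₁ + (δ ^ e₁) ^ q                 ≈⟨ +-cong (^-homo-* δ t q) (^-congˡ q (^-homo-* δ t q)) ⟩
        δ ^ t * δ ^ q + (δ ^ t * δ ^ q) ^ q   ≈⟨ +-congˡ (^-distrib-* (δ ^ t) (δ ^ q) q) ⟩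
        δ ^ t * δ ^ q + (δ ^ t) ^ q * (δ ^ q) ^ q
          ≈⟨ +-congˡ (trans (*-cong ([x^a]^b≈[x^b]^a δ t q) ([x^q]^q≈x δ)) (*-comm _ _)) ⟩
        cross δ (δ ^ q)                        ≈⟨ correction≈cross δ ⟨
        correction δ                           ∎

    Tr-^[t+1] : ∀ δ → Tr (δ ^ (t ℕ.+ 1)) ≈ Tr δ ^ (t ℕ.+ 1) + correction δ
    Tr-^[t+1] δ = begin
      δ ^ (t ℕ.+ 1) + (δ ^ (t ℕ.+ 1)) ^ q                        ≈⟨ +-congˡ ([x^a]^b≈[x^b]^a δ (t ℕ.+ 1) q) ⟩
      δ ^ (t ℕ.+ 1) + δ' ^ (t ℕ.+ 1)                             ≈⟨ x+[y+y]≈x _ (cross δ δ') ⟨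
      δ ^ (t ℕ.+ 1) + δ' ^ (t ℕ.+ 1) + (cross δ δ' + cross δ δ')
        ≈⟨ solve 3 (λ a b c → a :+ b :+ (c :+ c) := a :+ c :+ b :+ c) refl _ _ (cross δ δ') ⟩
      δ ^ (t ℕ.+ 1) + cross δ δ' + δ' ^ (t ℕ.+ 1) + cross δ δ'   ≈⟨ +-cong ([x+y]^[t+1] δ δ') (correction≈cross δ) ⟨
      (δ + δ') ^ (t ℕ.+ 1) + correction δ                        ∎
      where
      δ' : Carrier
      δ' = δ ^ q

    φ : Carrier → Carrier → Carrier
    φ δ z = (z ^ (t ∸ 1) + δ) ^ (t ℕ.+ 1)

    φ-congʳ : ∀ δ {z z'} → z ≈ z' → φ δ z ≈ φ δ z'
    φ-congʳ δ z≈z' = ^-congˡ (t ℕ.+ 1) (+-congʳ (^-congˡ (t ∸ 1) z≈z'))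

    Tr-φ : ∀ δ {z} → InSubfield z → Tr (φ δ z) ≈ z + φ (Tr δ) z + correction δ
    Tr-φ δ {z} z∈K = begin
      Tr ((a + δ) ^ (t ℕ.+ 1))                              ≈⟨ Tr-cong (expand δ) ⟩
      Tr (z + cross a δ + δ ^ (t ℕ.+ 1))                    ≈⟨ trans (Tr-+ _ _) (+-congʳ (Tr-+ _ _)) ⟩
      Tr z + Tr (cross a δ) + Tr (δ ^ (t ℕ.+ 1))            ≈⟨ +-cong (+-cong (Tr≈0 z∈K) (Tr-cross a∈K δ)) (Tr-^[t+1] δ) ⟩
      0# + cross a w + (w ^ (t ℕ.+ 1) + correction δ)       ≈⟨ +-congʳ (+-congʳ (x+x≈0 z)) ⟨
      (z + z) + cross a w + (w ^ (t ℕ.+ 1) + correction δ)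
        ≈⟨ solve 4 (λ z c p d → (z :+ z) :+ c :+ (p :+ d) := z :+ (z :+ c :+ p) :+ d)
                   refl z (cross a w) (w ^ (t ℕ.+ 1)) (correction δ) ⟩
      z + (z + cross a w + w ^ (t ℕ.+ 1)) + correction δ   ≈⟨ +-congʳ (+-congˡ (expand w)) ⟨
      z + (a + w) ^ (t ℕ.+ 1) + correction δ                ∎
      where
      a w : Carrier
      a = z ^ (t ∸ 1)
      w = Tr δ
      a∈K : InSubfield a
      a∈K = InSubfield-^ z∈K (t ∸ 1)
      expand : ∀ d → (a + d) ^ (t ℕ.+ 1) ≈ z + cross a d + d ^ (t ℕ.+ 1)
      expand d = trans ([x+y]^[t+1] a d) (+-congʳ (+-congʳ ([z^[t∸1]]^[t+1]≈z z∈K)))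

    φ-φ : ∀ {δ ε z} → InSubfield z → ε ≈ δ ^ q → φ ε (φ (Tr δ) z) ≈ φ δ z
    φ-φ {δ} {ε} {z} z∈K ε≈δ^q = ^-congˡ (t ℕ.+ 1) (begin
      φ (Tr δ) z ^ (t ∸ 1) + ε           ≈⟨ +-cong ([z^[t+1]]^[t∸1]≈z b∈K) ε≈δ^q ⟩
      z ^ (t ∸ 1) + Tr δ + δ ^ q         ≈⟨ +-assoc _ _ _ ⟩
      z ^ (t ∸ 1) + (Tr δ + δ ^ q)       ≈⟨ +-congˡ ([x+y]+y≈x δ (δ ^ q)) ⟩
      z ^ (t ∸ 1) + δ                    ∎)
      where
      b∈K : InSubfield (z ^ (t ∸ 1) + Tr δ)
      b∈K = InSubfield-+ (InSubfield-^ z∈K (t ∸ 1)) (InSubfield-Tr δ)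

    g : Carrier → Carrier → Carrier → Carrier
    g δ a x = x + φ δ (Tr x + a)

    g-cong : ∀ δ a {x y} → x ≈ y → g δ a x ≈ g δ a y
    g-cong δ a x≈y = +-cong x≈y (φ-congʳ δ (+-congʳ (Tr-cong x≈y)))

    g-inverse : ∀ {δ ε a b} → ε ≈ δ ^ q → InSubfield a → b + correction δ ≈ a → ∀ x → g ε b (g δ a x) ≈ x
    g-inverse {δ} {ε} {a} {b} ε≈δ^q a∈K b+c≈a x = begin
      y + φ ε (Tr y + b)           ≈⟨ +-congˡ (φ-congʳ ε Tr[y]+b≈φ) ⟩
      y + φ ε (φ (Tr δ) u)         ≈⟨ +-congˡ (φ-φ u∈K ε≈δ^q) ⟩
      x + φ δ u + φ δ u            ≈⟨ [x+y]+y≈x x (φ δ u) ⟩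
      x                            ∎
      where
      u y : Carrier
      u = Tr x + a
      y = g δ a x
      u∈K : InSubfield u
      u∈K = InSubfield-+ (InSubfield-Tr x) a∈K
      Tr[y]+b≈φ : Tr y + b ≈ φ (Tr δ) u
      Tr[y]+b≈φ = begin
        Tr (x + φ δ u) + b                                        ≈⟨ +-congʳ (Tr-+ x (φ δ u)) ⟩
        Tr x + Tr (φ δ u) + b                                     ≈⟨ +-congʳ (+-congˡ (Tr-φ δ u∈K)) ⟩
        Tr x + ((Tr x + a) + φ (Tr δ) u + correction δ) + b
          ≈⟨ solve 5 (λ r a p c b → r :+ ((r :+ a) :+ p :+ c) :+ b := p :+ ((r :+ r) :+ (a :+ (b :+ c))))
                     refl (Tr x) a (φ (Tr δ) u) (correction δ) b ⟩
        φ (Tr δ) u + ((Tr x + Tr x) + (a + (b + correction δ)))   ≈⟨ +-congˡ (+-cong (x+x≈0 (Tr x)) (+-congˡ b+c≈a)) ⟩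
        φ (Tr δ) u + (0# + (a + a))                               ≈⟨ +-congˡ (trans (+-identityˡ _) (x+x≈0 a)) ⟩
        φ (Tr δ) u + 0#                                           ≈⟨ +-identityʳ _ ⟩
        φ (Tr δ) u                                                ∎

    f≈g : ∀ δ x → f δ x ≈ g δ 0# x
    f≈g δ x = +-congˡ (φ-congʳ δ (sym (+-identityʳ (Tr x))))

    finv≈g : ∀ δ y → finv δ y ≈ g (δ ^ q) (correction δ) y
    finv≈g δ y = +-congˡ (φ-congʳ (δ ^ q) (+-assoc _ _ _))

    finv∘f≈id : ∀ δ x → finv δ (f δ x) ≈ x
    finv∘f≈id δ x = begin
      finv δ (f δ x)                         ≈⟨ finv≈g δ (f δ x) ⟩
      g (δ ^ q) (correction δ) (f δ x)       ≈⟨ g-cong (δ ^ q) (correction δ) (f≈g δ x) ⟩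
      g (δ ^ q) (correction δ) (g δ 0# x)    ≈⟨ g-inverse refl InSubfield-0# (x+x≈0 (correction δ)) x ⟩
      x                                      ∎

    f∘finv≈id : ∀ δ y → f δ (finv δ y) ≈ y
    f∘finv≈id δ y = begin
      f δ (finv δ y)                         ≈⟨ f≈g δ (finv δ y) ⟩
      g δ 0# (finv δ y)                      ≈⟨ g-cong δ 0# (finv≈g δ y) ⟩
      g δ 0# (g (δ ^ q) (correction δ) y)
        ≈⟨ g-inverse (sym ([x^q]^q≈x δ)) (InSubfield-correction δ) (trans (+-identityˡ _) (correction-^q δ)) y ⟩
      y                                      ∎

open import Data.Nat using (_^_; _*_; _<_)

theorem9 : ∀ {c ℓ} (R : CommutativeRing c ℓ) (m : ℕ) → 0 < m → m % 2 ≡ 1 →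
    IsFiniteFieldOfOrder R (2 ^ (2 * m)) →
    (δ : CommutativeRing.Carrier R) →
    (∀ x → CommutativeRing._≈_ R (OverRing.f R m δ (OverRing.finv R m δ x)) x)
    × (∀ x → CommutativeRing._≈_ R (OverRing.finv R m δ (OverRing.f R m δ x)) x)
theorem9 R m (s≤s z≤n) m-odd F δ = f∘finv≈id δ , finv∘f≈id δ
  where
  open FiniteField R using (x+x≈0; x^q≈x)
  open PermutationPolynomial R (x+x≈0 {k = 2 * m} F) m m-odd (x^q≈x F)
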